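{- Let $n\ge2$ and let $\mathcal{A}=(G,\theta)$ be the valued digraph with vertex set $\lambda_n=\{(a,b)\in[n]^2: a<b\}$, with an arc from $(a,b)$ to $(c,d)$ if and only if $(c,d)=(a,k)$ or $(c,d)=(k,b)$ for some integer $k$ with $a<k<b$, and with $\theta(a,b)=d^+(a,b)/2=b-a-1$. Then the symmetric group $S_n$ (the Coxeter group $A_{n-1}$) with the right weak order $\le_R$ is isomorphic, as a poset, to $(IS(\mathcal{A}),\subseteq)$.
   Context: Valued digraph: pair $(G,\theta)$, $G=(V,E)$ simple acyclic digraph, $\theta:V\to\mathbb{N}$ with $0\le\theta(x)\le d^+(x)$ (out-degree). A vertex $x$ is erasable if $\theta(x)=0$ and all $z$ with $(z,x)\in E$ have $\theta(z)\neq 0$. Peeling process: repeatedly choose an erasable vertex $x_i$ of the current valued digraph, delete it and its incident arcs, and decrease by $1$ the value of every $y$ having an arc $(y,x_i)$; stop when no erasable vertex exists. The sequences $[x_1,x_2,\dots]$ obtained are peeling sequences, and $IS(\mathcal{G})$ is the set of $\emptyset$ together with all sets $\{x_1,\dots,x_k\}$ ($k\ge1$) for peeling sequences. $S_n$ is generated by the simple transpositions $s_i=(i\ i+1)$, $1\le i\le n-1$, with length $\ell$; the right weak order is $w\le_R\tau$ iff $\tau=ws_{j_1}\cdots s_{j_k}$ with $\ell(\tau)=\ell(w)+k$. -}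

module Defs where

open import Data.Nat using (ℕ; zero; suc; _+_; _∸_; _≤_)
open import Data.Fin using (Fin; toℕ; inject₁) renaming (_<_ to _<ᶠ_)
open import Data.Fin.Permutation using (Permutation′; _∘ₚ_; _≈_; transpose; id)
open import Data.Empty using (⊥)
open import Data.List using (List; []; _∷_; length; filter; take; lookup; foldl)
open import Data.List.Membership.Propositional using (_∈_; _∉_)
open import Data.List.Relation.Binary.Subset.Propositional using (_⊆_)
open import Data.Product using (Σ; _×_; _,_; ∃; ∃-syntax; proj₁)
open import Data.Sum using (_⊎_)
open import Relation.Binary.PropositionalEquality using (_≡_; _≢_)
open import Relation.Nullary using (Dec; ¬_)
open import Function.Bundles using (_⇔_)

-- S_n : permutations of Fin n (equality is pointwise, _≈_)
Sym : ℕ → Set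
Sym n = Permutation′ n

-- indices of simple transpositions: s_i, 1 ≤ i ≤ n-1, encoded by Fin (n-1)
Gen : ℕ → Set
Gen zero    = ⊥
Gen (suc m) = Fin m

s : ∀ {n} → Gen n → Sym n
s {suc m} i = transpose (inject₁ i) (Data.Fin.suc i)

-- product  w · σ  as composition of maps: (w · σ)(x) = w (σ x)
_·_ : ∀ {n} → Sym n → Sym n → Sym n
w · σ = σ ∘ₚ w

_·word_ : ∀ {n} → Sym n → List (Gen n) → Sym n
w ·word js = foldl (λ u j → u · s j) w js

HasLength : ∀ {n} → Sym n → ℕ → Set
HasLength {n} w k =
  (Σ (List (Gen n)) λ js → length js ≡ k × (id ·word js) ≈ w)
  × (∀ (js : List (Gen n)) → (id ·word js) ≈ w → k ≤ length js)

_≤R_ : ∀ {n} → Sym n → Sym n → Set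
_≤R_ {n} w τ = Σ (List (Gen n)) λ js →
  ((w ·word js) ≈ τ)
  × (Σ ℕ λ lw → Σ ℕ λ lτ → HasLength w lw × HasLength τ lτ × lτ ≡ lw + length js)

record ValuedDigraph : Set₁ where
  field
    V    : Set
    _⇒_  : V → V → Set            -- arc relation (y ⇒ x means arc (y,x))
    _⇒?_ : ∀ y x → Dec (y ⇒ x)
    θ    : V → ℕ

module Peeling (𝒢 : ValuedDigraph) where
  open ValuedDigraph 𝒢

  val : List V → V → ℕ
  val ds y = θ y ∸ length (filter (y ⇒?_) ds)

  Erasable : List V → V → Set
  Erasable ds x =
    x ∉ ds × val ds x ≡ 0 ×
    (∀ z → z ∉ ds → z ⇒ x → val ds z ≢ 0)

  ValidRun : List V → Set
  ValidRun xs = ∀ (i : Fin (length xs)) → Erasable (take (toℕ i) xs) (lookup xs i)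

  PeelingSeq : List V → Set
  PeelingSeq xs = ValidRun xs × (∀ x → ¬ Erasable xs x)

  -- X ∈ IS(𝒢): X is ∅ or {x_1,...,x_k} for a peeling sequence [x_1,...]
  -- (sets represented by lists, compared by membership)
  InIS : List V → Set
  InIS X = Σ (List V) λ xs → PeelingSeq xs × Σ ℕ λ k → k ≤ length xs ×
           (∀ v → (v ∈ X) ⇔ (v ∈ take k xs))

Λ : ℕ → Set
Λ n = Σ (Fin n × Fin n) λ p → proj₁ p <ᶠ Data.Product.proj₂ p

Arc : ∀ {n} → Λ n → Λ n → Set
Arc {n} ((a , b) , _) ((c , d) , _) =
  Σ (Fin n) λ k → a <ᶠ k × k <ᶠ b × ((c ≡ a × d ≡ k) ⊎ (c ≡ k × d ≡ b))

Arc? : ∀ {n} (u v : Λ n) → Dec (Arc u v)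
Arc? ((a , b) , _) ((c , d) , _) =
  any? λ k → (a <? k) ×-dec (k <? b) ×-dec
             (((c ≟ a) ×-dec (d ≟ k)) ⊎-dec ((c ≟ k) ×-dec (d ≟ b)))
  where
  open import Data.Fin.Properties using (any?; _<?_; _≟_)
  open import Relation.Nullary.Decidable using (_×-dec_; _⊎-dec_)

𝒜 : ℕ → ValuedDigraph
𝒜 n = record
  { V    = Λ n
  ; _⇒_  = Arc
  ; _⇒?_ = Arc?
  ; θ    = λ { ((a , b) , _) → toℕ b ∸ toℕ a ∸ 1 }
  }

module _ (n : ℕ) where
  open Peeling (𝒜 n)

  IsPosetIso : (Sym n → List (Λ n)) → Set
  IsPosetIso f =
    (∀ w → InIS (f w))
    × (∀ X → InIS X → Σ (Sym n) λ w → ∀ v → (v ∈ f w) ⇔ (v ∈ X))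
    × (∀ w τ → (∀ v → (v ∈ f w) ⇔ (v ∈ f τ)) → w ≈ τ)
    × (∀ w τ → (w ≤R τ) ⇔ (f w ⊆ f τ))

module Submission where

-- Permutations are studied through their inversion sets.  Right
-- multiplication by s_i adds exactly one inversion at an ascent i (the pair
-- of entries at positions i, i+1) and removes one at a descent, and a
-- permutation is determined by its inversion set.  Hence the length of w is
-- its number of inversions, and  w ≤_R τ  iff  inv(w) ⊆ inv(τ).
--
-- For the valued digraph 𝒜, if the deleted vertices are exactly the
-- inversions of u, the value of a remaining vertex (c,d) counts the entries
-- strictly between c and d in value that also stand between them in u.  From
-- this, the erasable vertices are exactly those created at the ascents of u.
-- So erasing a vertex is multiplying by an ascent s_i: prefixes of peeling
-- sequences are inversion sets, and every inversion set is the prefix erased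
-- along a reduced word.

open import Defs
open import Data.Nat as ℕ using (ℕ; zero; suc; _+_; _∸_; _≤_; _<_; z≤n; s≤s)
import Data.Nat.Properties as NP
open import Data.Fin as F using (Fin; toℕ; inject₁; fromℕ<)
import Data.Fin.Properties as FP
open import Data.Fin.Permutation using (_⟨$⟩ʳ_; _⟨$⟩ˡ_; inverseˡ; inverseʳ; _≈_; id)
import Data.Fin.Permutation.Components as PC
open import Data.List using (List; []; _∷_; length; filter; map; upTo; allFin; cartesianProduct; _++_; [_]; take; lookup)
import Data.List.Properties as LP
open import Data.List.Membership.Propositional using (_∈_; _∉_; _─_)
open import Data.List.Membership.Propositional.Properties using (∈-filter⁺; ∈-filter⁻; ∈-map⁺; ∈-map⁻; ∈-upTo⁺; ∈-upTo⁻; ∈-allFin; ∈-cartesianProduct⁺; ∈-++⁺ˡ; ∈-++⁺ʳ; ∈-++⁻)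
open import Data.List.Relation.Unary.Any using (here; there; index)
import Data.List.Relation.Unary.All as All
open import Data.List.Relation.Unary.All.Properties using (all-filter) renaming (map⁺ to All-map⁺)
open import Data.List.Relation.Unary.Unique.Propositional using (Unique; []; _∷_)
import Data.List.Relation.Unary.Unique.Propositional.Properties as UP
open import Data.List.Relation.Binary.Subset.Propositional using (_⊆_)
open import Data.List.Extrema NP.≤-totalOrder using (argmin; argmax; argmin-all; argmax-all; f[argmin]≤f[xs]; f[xs]≤f[argmax])
open import Data.Product using (Σ; _×_; _,_; proj₁; proj₂)
open import Data.Sum using (_⊎_; inj₁; inj₂)
open import Data.Empty using (⊥; ⊥-elim)
open import Relation.Unary using (Decidable)
open import Relation.Nullary using (Dec; yes; no; ¬_)
open import Relation.Nullary.Decidable using (_×-dec_)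
open import Relation.Binary.Definitions using (tri<; tri≈; tri>)
open import Relation.Binary.PropositionalEquality using (_≡_; refl; sym; trans; cong; subst; subst₂; _≢_; module ≡-Reasoning)
open import Function.Bundles using (_⇔_; mk⇔; Equivalence)
import Function.Properties.Equivalence as ⇔

∈-─ : ∀ {A : Set} {x z : A} {xs} (p : x ∈ xs) → z ∈ xs → z ≢ x → z ∈ xs ─ p
∈-─ (here refl) (here refl) z≢x = ⊥-elim (z≢x refl)
∈-─ (here refl) (there q)   _   = q
∈-─ (there p)   (here refl) _   = here refl
∈-─ (there p)   (there q)   z≢x = there (∈-─ p q z≢x)

unique⊆⇒length≤ : ∀ {A : Set} {xs ys : List A} → Unique xs →
                  (∀ {z} → z ∈ xs → z ∈ ys) → length xs ≤ length ys
unique⊆⇒length≤ [] _ = z≤n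
unique⊆⇒length≤ {xs = x ∷ xs} {ys} (x∉xs ∷ u) xs⊆ys =
  subst (suc (length xs) ≤_) (sym (LP.length-removeAt′ ys (index x∈ys)))
        (s≤s (unique⊆⇒length≤ u tail⊆))
  where
  x∈ys : x ∈ ys
  x∈ys = xs⊆ys (here refl)
  tail⊆ : ∀ {z} → z ∈ xs → z ∈ ys ─ x∈ys
  tail⊆ z∈xs = ∈-─ x∈ys (xs⊆ys (there z∈xs)) (λ z≡x → All.lookup x∉xs z∈xs (sym z≡x))

unique-map : ∀ {A B : Set} (f : A → B) {xs : List A} → Unique xs →
             (∀ {x y} → x ∈ xs → y ∈ xs → f x ≡ f y → x ≡ y) → Unique (map f xs)
unique-map f [] _ = []
unique-map f (x∉xs ∷ u) inj =
  All-map⁺ (All.tabulate (λ y∈xs fx≡fy → All.lookup x∉xs y∈xs (inj (here refl) (there y∈xs) fx≡fy)))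
  ∷ unique-map f u (λ p q → inj (there p) (there q))

module _ {n} (Q : Fin n → Set) (Q? : Decidable Q) where
  private
    witnesses : List (Fin n)
    witnesses = filter Q? (allFin n)

    witness∈ : ∀ {k} → Q k → k ∈ witnesses
    witness∈ qk = ∈-filter⁺ Q? (∈-allFin _) qk

  leastWitness : ∀ {v} → Q v → Σ (Fin n) λ d → Q d × (∀ k → Q k → d F.≤ k)
  leastWitness {v} qv =
    argmin toℕ v witnesses ,
    argmin-all toℕ qv (all-filter Q? (allFin n)) ,
    λ k qk → All.lookup (f[argmin]≤f[xs] v witnesses) (witness∈ qk)

  greatestWitness : ∀ {v} → Q v → Σ (Fin n) λ d → Q d × (∀ k → Q k → k F.≤ d)
  greatestWitness {v} qv =
    argmax toℕ v witnesses ,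
    argmax-all toℕ qv (all-filter Q? (allFin n)) ,
    λ k qk → All.lookup (f[xs]≤f[argmax] v witnesses) (witness∈ qk)

-- The naturals strictly between c and d, without repetition; there are
-- d ∸ c ∸ 1 of them, which is the value θ(c,d) of the vertex (c,d).
between : ℕ → ℕ → List ℕ
between c d = map (λ j → suc (c + j)) (upTo (d ∸ c ∸ 1))

length-between : ∀ c d → length (between c d) ≡ d ∸ c ∸ 1
length-between c d = trans (LP.length-map _ (upTo (d ∸ c ∸ 1))) (LP.length-upTo _)

unique-between : ∀ c d → Unique (between c d)
unique-between c d = UP.map⁺ (λ e → NP.+-cancelˡ-≡ c _ _ (NP.suc-injective e)) (UP.upTo⁺ _)

private
  ∸-suc : ∀ c d → d ∸ c ∸ 1 ≡ d ∸ suc c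
  ∸-suc c d = trans (NP.∸-+-assoc d c 1) (cong (d ∸_) (NP.+-comm c 1))

∈-between⁻ : ∀ {c d z} → c < d → z ∈ between c d → c < z × z < d
∈-between⁻ {c} {d} c<d z∈ with ∈-map⁻ (λ j → suc (c + j)) z∈
... | j , j∈ , refl =
  s≤s (NP.m≤m+n c j) ,
  subst (suc c + j <_) (NP.m+[n∸m]≡n c<d)
        (NP.+-monoʳ-< (suc c) (subst (j <_) (∸-suc c d) (∈-upTo⁻ j∈)))

∈-between⁺ : ∀ {c d z} → c < z → z < d → z ∈ between c d
∈-between⁺ {c} {d} {z} c<z z<d =
  subst (_∈ between c d) (NP.m+[n∸m]≡n c<z)
    (∈-map⁺ (λ j → suc (c + j)) (∈-upTo⁺ (subst (z ∸ suc c <_) (sym (∸-suc c d)) (NP.∸-monoˡ-< z<d c<z))))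

module _ {n} (i j : Fin n) where
  transpose-first : PC.transpose i j i ≡ j
  transpose-first with i FP.≟ i
  ... | yes _   = refl
  ... | no i≢i  = ⊥-elim (i≢i refl)

  transpose-second : i ≢ j → PC.transpose i j j ≡ i
  transpose-second i≢j with j FP.≟ i
  ... | yes j≡i = ⊥-elim (i≢j (sym j≡i))
  ... | no _ with j FP.≟ j
  ...   | yes _  = refl
  ...   | no j≢j = ⊥-elim (j≢j refl)

  transpose-other : ∀ k → k ≢ i → k ≢ j → PC.transpose i j k ≡ k
  transpose-other k k≢i k≢j with k FP.≟ i
  ... | yes k≡i = ⊥-elim (k≢i k≡i)
  ... | no _ with k FP.≟ j
  ...   | yes k≡j = ⊥-elim (k≢j k≡j)
  ...   | no _    = refl

  transpose-involutive : i ≢ j → ∀ k → PC.transpose i j (PC.transpose i j k) ≡ k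
  transpose-involutive i≢j k = by-cases (k FP.≟ i) (k FP.≟ j)
    where
    open ≡-Reasoning
    twice : Fin n → Fin n
    twice z = PC.transpose i j (PC.transpose i j z)
    by-cases : Dec (k ≡ i) → Dec (k ≡ j) → twice k ≡ k
    by-cases (yes k≡i) _ = begin
      twice k                        ≡⟨ cong twice k≡i ⟩
      PC.transpose i j (PC.transpose i j i) ≡⟨ cong (PC.transpose i j) transpose-first ⟩
      PC.transpose i j j             ≡⟨ transpose-second i≢j ⟩
      i                              ≡⟨ sym k≡i ⟩
      k                              ∎
    by-cases (no _) (yes k≡j) = begin
      twice k                        ≡⟨ cong twice k≡j ⟩
      PC.transpose i j (PC.transpose i j j) ≡⟨ cong (PC.transpose i j) (transpose-second i≢j) ⟩
      PC.transpose i j i             ≡⟨ transpose-first ⟩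
      j                              ≡⟨ sym k≡j ⟩
      k                              ∎
    by-cases (no k≢i) (no k≢j) =
      trans (cong (PC.transpose i j) (transpose-other k k≢i k≢j)) (transpose-other k k≢i k≢j)

module Permutations (m : ℕ) where

  Perm : Set
  Perm = Sym (suc m)

  Pt : Set
  Pt = Fin (suc m)

  -- one-line notation: the entry of w at position x, and the position of
  -- the entry x  (so  pos w  is the inverse permutation)
  at pos : Perm → Pt → Pt
  at w x = w ⟨$⟩ʳ x
  pos w x = w ⟨$⟩ˡ x

  at-pos : ∀ w x → at w (pos w x) ≡ x
  at-pos w x = inverseʳ w

  pos-at : ∀ w x → pos w (at w x) ≡ x
  pos-at w x = inverseˡ w

  pos-injective : ∀ w {x y} → pos w x ≡ pos w y → x ≡ y
  pos-injective w {x} {y} e = trans (sym (at-pos w x)) (trans (cong (at w) e) (at-pos w y))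

  at-injective : ∀ w {x y} → at w x ≡ at w y → x ≡ y
  at-injective w {x} {y} e = trans (sym (pos-at w x)) (trans (cong (pos w) e) (pos-at w y))

  pos-cong : ∀ {w τ} → w ≈ τ → ∀ x → pos w x ≡ pos τ x
  pos-cong {w} {τ} w≈τ x =
    trans (sym (pos-at τ (pos w x))) (cong (pos τ) (trans (sym (w≈τ (pos w x))) (at-pos w x)))

  ≈-sym : ∀ {w τ : Perm} → w ≈ τ → τ ≈ w
  ≈-sym e x = sym (e x)

  ≈-trans : ∀ {w τ ρ : Perm} → w ≈ τ → τ ≈ ρ → w ≈ ρ
  ≈-trans e f x = trans (e x) (f x)

  ·-congˡ : ∀ {w τ : Perm} (σ : Perm) → w ≈ τ → (w · σ) ≈ (τ · σ)
  ·-congˡ σ e x = e (σ ⟨$⟩ʳ x)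

  inject₁≢suc : (i : Fin m) → inject₁ i ≢ F.suc i
  inject₁≢suc i e = NP.<⇒≢ (NP.n<1+n (toℕ i)) (trans (sym (FP.toℕ-inject₁ i)) (cong toℕ e))

  inject₁<suc : (i : Fin m) → inject₁ i F.< F.suc i
  inject₁<suc i = FP.≤̄⇒inject₁< FP.≤-refl

  s-involutive : ∀ (w : Perm) (i : Fin m) → ((w · s i) · s i) ≈ w
  s-involutive w i x = cong (at w) (transpose-involutive (inject₁ i) (F.suc i) (inject₁≢suc i) x)

  -- On positions, right multiplication by s i acts by  swap i :
  -- pos (w · s i) x  is definitionally  swap i (pos w x).
  swap : Fin m → Pt → Pt
  swap i = PC.transpose (F.suc i) (inject₁ i)

  data SwapView (i : Fin m) : Pt → Pt → Set where
    atSuc     : SwapView i (F.suc i) (inject₁ i)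
    atInject  : SwapView i (inject₁ i) (F.suc i)
    elsewhere : ∀ {p} → p ≢ F.suc i → p ≢ inject₁ i → SwapView i p p

  swap-view : ∀ i p → SwapView i p (swap i p)
  swap-view i p = by-cases (p FP.≟ F.suc i) (p FP.≟ inject₁ i)
    where
    by-cases : Dec (p ≡ F.suc i) → Dec (p ≡ inject₁ i) → SwapView i p (swap i p)
    by-cases (yes refl) _ = subst (SwapView i p) (sym (transpose-first (F.suc i) (inject₁ i))) atSuc
    by-cases (no _) (yes refl) =
      subst (SwapView i p) (sym (transpose-second (F.suc i) (inject₁ i) (λ e → inject₁≢suc i (sym e)))) atInject
    by-cases (no p≢s) (no p≢i) =
      subst (SwapView i p) (sym (transpose-other (F.suc i) (inject₁ i) p p≢s p≢i)) (elsewhere p≢s p≢i)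

  swap-monotone : ∀ (i : Fin m) {p q : Pt} → p F.< q → ¬ (p ≡ inject₁ i × q ≡ F.suc i) →
                  swap i p F.< swap i q
  swap-monotone i {p} {q} p<q notSwapped
    with swap i p | swap-view i p | swap i q | swap-view i q
  ... | _ | atSuc | _ | atSuc = ⊥-elim (NP.<-irrefl refl p<q)
  ... | _ | atSuc | _ | atInject = ⊥-elim (NP.<-asym p<q (inject₁<suc i))
  ... | _ | atSuc | _ | elsewhere _ _ = FP.<-trans (inject₁<suc i) p<q
  ... | _ | atInject | _ | atSuc = ⊥-elim (notSwapped (refl , refl))
  ... | _ | atInject | _ | atInject = ⊥-elim (NP.<-irrefl refl p<q)
  ... | _ | atInject | _ | elsewhere q≢s _ =
    FP.≤∧≢⇒< (subst (ℕ._< toℕ q) (FP.toℕ-inject₁ i) p<q) (λ e → q≢s (sym e))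
  ... | _ | elsewhere _ p≢i | _ | atSuc =
    FP.≤∧≢⇒< (subst (toℕ p ≤_) (sym (FP.toℕ-inject₁ i)) (NP.≤-pred p<q)) p≢i
  ... | _ | elsewhere _ _ | _ | atInject = FP.<-trans p<q (inject₁<suc i)
  ... | _ | elsewhere _ _ | _ | elsewhere _ _ = p<q

  module _ (h : Pt → Pt) (increasing : ∀ (i : Fin m) → h (inject₁ i) F.< h (F.suc i)) where
    private
      -- from position 0 upwards, h gains at least one at every step
      above : ∀ k (x : Pt) → toℕ x ≡ k → k ≤ toℕ (h x)
      above zero    x         _ = z≤n
      above (suc k) F.zero    ()
      above (suc k) (F.suc i) e =
        NP.≤-<-trans (above k (inject₁ i) (trans (FP.toℕ-inject₁ i) (NP.suc-injective e))) (increasing i)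

      -- from position m downwards, h loses at least one at every step
      below : ∀ d (x : Pt) → toℕ x + d ≡ m → toℕ (h x) ≤ toℕ x
      below zero x e =
        subst (toℕ (h x) ≤_) (trans (sym e) (NP.+-identityʳ (toℕ x))) (NP.≤-pred (FP.toℕ<n (h x)))
      below (suc d) x e = subst (λ z → toℕ (h z) ≤ toℕ z) (sym x≡i) h[i]≤i
        where
        x<m : toℕ x < m
        x<m = subst (toℕ x <_) e (NP.m<m+n (toℕ x) (s≤s z≤n))
        i : Fin m
        i = fromℕ< x<m
        x≡i : x ≡ inject₁ i
        x≡i = FP.toℕ-injective (trans (sym (FP.toℕ-fromℕ< x<m)) (sym (FP.toℕ-inject₁ i)))
        h[i]≤i : toℕ (h (inject₁ i)) ≤ toℕ (inject₁ i)
        h[i]≤i = subst (toℕ (h (inject₁ i)) ≤_) (sym (FP.toℕ-inject₁ i))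
          (NP.≤-pred (NP.<-≤-trans (increasing i)
            (below d (F.suc i) (trans (cong (λ z → suc z + d) (FP.toℕ-fromℕ< x<m)) (trans (sym (NP.+-suc (toℕ x) d)) e)))))

    adjacent-increasing⇒id : ∀ x → h x ≡ x
    adjacent-increasing⇒id x = FP.toℕ-injective (NP.≤-antisym
      (below (m ∸ toℕ x) x (NP.m+[n∸m]≡n (NP.≤-pred (FP.toℕ<n x))))
      (above (toℕ x) x refl))

  same-order⇒≈ : ∀ (w τ : Perm) → (∀ (i : Fin m) → pos τ (at w (inject₁ i)) F.< pos τ (at w (F.suc i))) → w ≈ τ
  same-order⇒≈ w τ increasing x =
    trans (sym (at-pos τ (at w x))) (cong (at τ) (adjacent-increasing⇒id (λ y → pos τ (at w y)) increasing x))

-- Inversion sets.  A vertex (a,b), a < b, of λ_{m+1} is an inversion of w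
-- when the value b occurs before the value a in w.
module Inversions (m : ℕ) where
  open Permutations m

  Vx : Set
  Vx = Λ (suc m)

  vertex-≡ : ∀ {a b a' b' : Pt} {a<b a'<b'} → a ≡ a' → b ≡ b' →
             _≡_ {A = Vx} ((a , b) , a<b) ((a' , b') , a'<b')
  vertex-≡ {a<b = a<b} {a'<b'} refl refl = cong (λ p → (_ , p)) (FP.<-irrelevant a<b a'<b')

  increasingPairs : List (Pt × Pt) → List Vx
  increasingPairs [] = []
  increasingPairs ((a , b) ∷ ps) with a F.<? b
  ... | yes a<b = ((a , b) , a<b) ∷ increasingPairs ps
  ... | no _    = increasingPairs ps

  ∈-increasingPairs⁺ : ∀ {ps} (y : Vx) → proj₁ y ∈ ps → y ∈ increasingPairs ps
  ∈-increasingPairs⁺ {(a , b) ∷ ps} y y∈ with a F.<? b | y∈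
  ... | yes _   | here refl = here (vertex-≡ refl refl)
  ... | yes _   | there y∈' = there (∈-increasingPairs⁺ y y∈')
  ... | no a≮b  | here refl = ⊥-elim (a≮b (proj₂ y))
  ... | no _    | there y∈' = ∈-increasingPairs⁺ y y∈'

  ∈-increasingPairs⁻ : ∀ {ps} {y : Vx} → y ∈ increasingPairs ps → proj₁ y ∈ ps
  ∈-increasingPairs⁻ {(a , b) ∷ ps} y∈ with a F.<? b | y∈
  ... | yes _ | here refl = here refl
  ... | yes _ | there y∈' = there (∈-increasingPairs⁻ y∈')
  ... | no _  | y∈'       = there (∈-increasingPairs⁻ y∈')

  unique-increasingPairs : ∀ {ps} → Unique ps → Unique (increasingPairs ps)
  unique-increasingPairs {[]} _ = []
  unique-increasingPairs {(a , b) ∷ ps} (p∉ps ∷ u) with a F.<? b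
  ... | yes _ = All.tabulate (λ y∈ e → All.lookup p∉ps (∈-increasingPairs⁻ y∈) (cong proj₁ e))
                ∷ unique-increasingPairs u
  ... | no _  = unique-increasingPairs u

  allVertices : List Vx
  allVertices = increasingPairs (cartesianProduct (allFin (suc m)) (allFin (suc m)))

  ∈-allVertices : ∀ y → y ∈ allVertices
  ∈-allVertices y = ∈-increasingPairs⁺ y (∈-cartesianProduct⁺ (∈-allFin _) (∈-allFin _))

  unique-allVertices : Unique allVertices
  unique-allVertices = unique-increasingPairs (UP.cartesianProduct⁺ (UP.allFin⁺ _) (UP.allFin⁺ _))

  record Inversion (w : Perm) (y : Vx) : Set where
    constructor inversion
    field inverted : pos w (proj₂ (proj₁ y)) F.< pos w (proj₁ (proj₁ y))
  open Inversion public

  Inversion? : ∀ w y → Dec (Inversion w y)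
  Inversion? w ((a , b) , _) with pos w b F.<? pos w a
  ... | yes b<a = yes (inversion b<a)
  ... | no b≮a  = no (λ i → b≮a (inverted i))

  -- the map  w ↦ inversions w  is the isomorphism of the theorem
  inversions : Perm → List Vx
  inversions w = filter (Inversion? w) allVertices

  -- the number of inversions (it will turn out to be the length)
  ninv : Perm → ℕ
  ninv w = length (inversions w)

  ∈-inversions⁺ : ∀ {w y} → Inversion w y → y ∈ inversions w
  ∈-inversions⁺ {w} {y} i = ∈-filter⁺ (Inversion? w) (∈-allVertices y) i

  ∈-inversions⁻ : ∀ {w y} → y ∈ inversions w → Inversion w y
  ∈-inversions⁻ {w} y∈ = proj₂ (∈-filter⁻ (Inversion? w) {xs = allVertices} y∈)

  unique-inversions : ∀ w → Unique (inversions w)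
  unique-inversions w = UP.filter⁺ (Inversion? w) unique-allVertices

  _⊑_ : Perm → Perm → Set
  w ⊑ τ = ∀ {y} → Inversion w y → Inversion τ y

  ⊑⇒⊆ : ∀ {w τ} → w ⊑ τ → inversions w ⊆ inversions τ
  ⊑⇒⊆ w⊑τ y∈ = ∈-inversions⁺ (w⊑τ (∈-inversions⁻ y∈))

  ⊆⇒⊑ : ∀ {w τ} → inversions w ⊆ inversions τ → w ⊑ τ
  ⊆⇒⊑ w⊆τ inv = ∈-inversions⁻ (w⊆τ (∈-inversions⁺ inv))

  ninv-mono : ∀ {w τ} → w ⊑ τ → ninv w ≤ ninv τ
  ninv-mono {w} w⊑τ = unique⊆⇒length≤ (unique-inversions w) (⊑⇒⊆ w⊑τ)

  Inversion-cong : ∀ {w τ} → w ≈ τ → w ⊑ τ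
  Inversion-cong {w} {τ} w≈τ {(a , b) , _} (inversion b<a) =
    inversion (subst₂ F._<_ (pos-cong {w} {τ} w≈τ b) (pos-cong {w} {τ} w≈τ a) b<a)

  ninv-cong : ∀ {w τ} → w ≈ τ → ninv w ≡ ninv τ
  ninv-cong {w} {τ} w≈τ =
    NP.≤-antisym (ninv-mono (Inversion-cong {w} {τ} w≈τ)) (ninv-mono (Inversion-cong {τ} {w} (≈-sym {w} {τ} w≈τ)))

  no-inversion-id : ∀ {y} → ¬ Inversion id y
  no-inversion-id {(a , b) , a<b} (inversion b<a) = NP.<-asym a<b b<a

  ninv-id : ninv id ≡ 0
  ninv-id = NP.n≤0⇒n≡0 (unique⊆⇒length≤ {ys = []} (unique-inversions id)
                         (λ y∈ → ⊥-elim (no-inversion-id (∈-inversions⁻ y∈))))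

  -- bound used to bound how long the peeling process can run
  ninv≤#vertices : ∀ w → ninv w ≤ length allVertices
  ninv≤#vertices w = LP.length-filter (Inversion? w) allVertices

  ninv-extend : ∀ {u v} (x : Vx) → ¬ Inversion u x → Inversion v x → u ⊑ v →
                (∀ {y} → Inversion v y → Inversion u y ⊎ y ≡ x) → ninv v ≡ suc (ninv u)
  ninv-extend {u} {v} x x∉u x∈v u⊑v v⊑u+x = NP.≤-antisym
    (unique⊆⇒length≤ (unique-inversions v) (λ y∈ → into (v⊑u+x (∈-inversions⁻ y∈))))
    (unique⊆⇒length≤ (All.tabulate (λ y∈ x≡y → x∉u (subst (Inversion u) (sym x≡y) (∈-inversions⁻ y∈)))
                      ∷ unique-inversions u) outof)
    where
    into : ∀ {y} → Inversion u y ⊎ y ≡ x → y ∈ x ∷ inversions u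
    into (inj₁ i) = there (∈-inversions⁺ i)
    into (inj₂ e) = here e
    outof : ∀ {z} → z ∈ x ∷ inversions u → z ∈ inversions v
    outof (here refl) = ∈-inversions⁺ x∈v
    outof (there z∈)  = ∈-inversions⁺ (u⊑v (∈-inversions⁻ z∈))

  Ascent Descent : Perm → Fin m → Set
  Ascent  u i = at u (inject₁ i) F.< at u (F.suc i)
  Descent u i = at u (F.suc i) F.< at u (inject₁ i)

  ascent-or-descent : ∀ u i → Ascent u i ⊎ Descent u i
  ascent-or-descent u i with FP.<-cmp (at u (inject₁ i)) (at u (F.suc i))
  ... | tri< asc _ _ = inj₁ asc
  ... | tri≈ _ e _   = ⊥-elim (inject₁≢suc i (at-injective u e))
  ... | tri> _ _ dsc = inj₂ dsc

  -- the vertex formed by the entries at an ascent i; it is the one new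
  -- inversion of  u · s i
  created : ∀ u i → Ascent u i → Vx
  created u i asc = (at u (inject₁ i) , at u (F.suc i)) , asc

  created-new : ∀ u i asc → ¬ Inversion u (created u i asc)
  created-new u i asc (inversion lt) rewrite pos-at u (inject₁ i) | pos-at u (F.suc i) =
    NP.<-asym lt (inject₁<suc i)

  created-after : ∀ u i asc → Inversion (u · s i) (created u i asc)
  created-after u i asc = inversion (subst₂ F._<_ (sym swap-suc) (sym swap-inject₁) (inject₁<suc i))
    where
    swap-suc : swap i (pos u (at u (F.suc i))) ≡ inject₁ i
    swap-suc = trans (cong (swap i) (pos-at u (F.suc i))) (transpose-first (F.suc i) (inject₁ i))
    swap-inject₁ : swap i (pos u (at u (inject₁ i))) ≡ F.suc i
    swap-inject₁ = trans (cong (swap i) (pos-at u (inject₁ i)))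
                         (transpose-second (F.suc i) (inject₁ i) (λ e → inject₁≢suc i (sym e)))

  private
    swapped? : ∀ (i : Fin m) p q → Dec (p ≡ inject₁ i × q ≡ F.suc i)
    swapped? i p q = (p FP.≟ inject₁ i) ×-dec (q FP.≟ F.suc i)

  -- at an ascent, u · s i keeps all inversions of u and adds only the
  -- created one: s i moves only the adjacent entries at i and i+1
  inversions-kept : ∀ u i → Ascent u i → u ⊑ (u · s i)
  inversions-kept u i asc {(x , z) , x<z} (inversion z<x) with swapped? i (pos u z) (pos u x)
  ... | no notSwapped = inversion (swap-monotone i z<x notSwapped)
  ... | yes (z≡ , x≡) = ⊥-elim (NP.<-asym x<z
          (subst₂ F._<_ (trans (cong (at u) (sym z≡)) (at-pos u z)) (trans (cong (at u) (sym x≡)) (at-pos u x)) asc))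

  inversions-added : ∀ u i asc {y} → Inversion (u · s i) y → Inversion u y ⊎ y ≡ created u i asc
  inversions-added u i asc {(x , z) , x<z} (inversion swapped-z<x) with FP.<-cmp (pos u z) (pos u x)
  ... | tri< z<x _ _ = inj₁ (inversion z<x)
  ... | tri≈ _ e _   = ⊥-elim (FP.<⇒≢ x<z (sym (pos-injective u e)))
  ... | tri> _ _ x<z' with swapped? i (pos u x) (pos u z)
  ...   | no notSwapped = ⊥-elim (NP.<-asym swapped-z<x (swap-monotone i x<z' notSwapped))
  ...   | yes (x≡ , z≡) = inj₂ (vertex-≡ (trans (sym (at-pos u x)) (cong (at u) x≡))
                                         (trans (sym (at-pos u z)) (cong (at u) z≡)))

  ninv-ascent : ∀ u i → Ascent u i → ninv (u · s i) ≡ suc (ninv u)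
  ninv-ascent u i asc =
    ninv-extend (created u i asc) (created-new u i asc) (created-after u i asc)
                (inversions-kept u i asc) (inversions-added u i asc)

  -- a descent of u is an ascent of u · s i, which undoes the step
  ascent-after-descent : ∀ u i → Descent u i → Ascent (u · s i) i
  ascent-after-descent u i dsc
    rewrite transpose-first (inject₁ i) (F.suc i) | transpose-second (inject₁ i) (F.suc i) (inject₁≢suc i) = dsc

  ninv-descent : ∀ u i → Descent u i → ninv u ≡ suc (ninv (u · s i))
  ninv-descent u i dsc =
    trans (ninv-cong {u} {(u · s i) · s i} (≈-sym {(u · s i) · s i} {u} (s-involutive u i)))
          (ninv-ascent (u · s i) i (ascent-after-descent u i dsc))

  ninv-step≤ : ∀ u i → ninv (u · s i) ≤ suc (ninv u)
  ninv-step≤ u i with ascent-or-descent u i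
  ... | inj₁ asc = NP.≤-reflexive (ninv-ascent u i asc)
  ... | inj₂ dsc = NP.≤-trans (subst (ninv (u · s i) ≤_) (sym (ninv-descent u i dsc)) (NP.n≤1+n _)) (NP.n≤1+n _)

  -- If τ has all inversions of w but none of the vertices created at the
  -- ascents of w, then τ orders every two adjacent entries of w as w does,
  -- hence τ = w.
  ⊑-without-created⇒≈ : ∀ w τ → w ⊑ τ → (∀ i asc → ¬ Inversion τ (created w i asc)) → w ≈ τ
  ⊑-without-created⇒≈ w τ w⊑τ none = same-order⇒≈ w τ same-order
    where
    same-order : ∀ i → pos τ (at w (inject₁ i)) F.< pos τ (at w (F.suc i))
    same-order i with ascent-or-descent w i
    ... | inj₁ asc = FP.≤∧≢⇒< (NP.≮⇒≥ (λ lt → none i asc (inversion lt)))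
                              (λ e → inject₁≢suc i (at-injective w (pos-injective τ e)))
    ... | inj₂ dsc = inverted (w⊑τ {(at w (F.suc i) , at w (inject₁ i)) , dsc}
                       (inversion (subst₂ F._<_ (sym (pos-at w (inject₁ i))) (sym (pos-at w (F.suc i))) (inject₁<suc i))))

  inversions-injective : ∀ {w τ} → w ⊑ τ → τ ⊑ w → w ≈ τ
  inversions-injective {w} {τ} w⊑τ τ⊑w =
    ⊑-without-created⇒≈ w τ w⊑τ (λ i asc inv → created-new w i asc (τ⊑w inv))

-- The length function equals the number of inversions, and a word is
-- reduced exactly when every letter creates an inversion.
module Length (m : ℕ) where
  open Permutations m
  open Inversions m

  ·word-snoc : ∀ (u : Perm) (js : List (Fin m)) i → (u ·word (js ++ [ i ])) ≡ ((u ·word js) · s i)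
  ·word-snoc u []       i = refl
  ·word-snoc u (j ∷ js) i = ·word-snoc (u · s j) js i

  ninv-word≤ : ∀ (js : List (Fin m)) (u : Perm) → ninv (u ·word js) ≤ ninv u + length js
  ninv-word≤ []       u = NP.≤-reflexive (sym (NP.+-identityʳ _))
  ninv-word≤ (j ∷ js) u = NP.≤-trans (ninv-word≤ js (u · s j))
    (subst (ninv (u · s j) + length js ≤_) (sym (NP.+-suc (ninv u) (length js)))
      (NP.+-monoˡ-≤ (length js) (ninv-step≤ u j)))

  ninv≤length : ∀ (js : List (Fin m)) (w : Perm) → (id ·word js) ≈ w → ninv w ≤ length js
  ninv≤length js w e = subst (_≤ length js) (ninv-cong {id ·word js} {w} e)
    (subst (λ z → ninv (id ·word js) ≤ z + length js) ninv-id (ninv-word≤ js id))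

  descent-free⇒id : ∀ w → (∀ i → ¬ Descent w i) → w ≈ id
  descent-free⇒id w noDescent = same-order⇒≈ w id ascending
    where
    ascending : ∀ i → at w (inject₁ i) F.< at w (F.suc i)
    ascending i with ascent-or-descent w i
    ... | inj₁ asc = asc
    ... | inj₂ dsc = ⊥-elim (noDescent i dsc)

  -- conversely, removing descents one at a time gives a word of length ninv w
  reducedWord : ∀ k (w : Perm) → ninv w ≡ k → Σ (List (Fin m)) λ js → length js ≡ k × (id ·word js) ≈ w
  reducedWord k w e with FP.any? (λ i → at w (F.suc i) F.<? at w (inject₁ i))
  reducedWord k w e | no noDescent =
    [] , trans (sym ninv-id) (trans (sym (ninv-cong {w} {id} w≈id)) e) , ≈-sym {w} {id} w≈id
    where
    w≈id : w ≈ id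
    w≈id = descent-free⇒id w (λ i dsc → noDescent (i , dsc))
  reducedWord zero w e | yes (i , dsc) = ⊥-elim (NP.0≢1+n (trans (sym e) (ninv-descent w i dsc)))
  reducedWord (suc k) w e | yes (i , dsc)
    with reducedWord k (w · s i) (NP.suc-injective (trans (sym (ninv-descent w i dsc)) e))
  ... | js , len , js≈ = js ++ [ i ] , length-snoc , word≈w
    where
    length-snoc : length (js ++ [ i ]) ≡ suc k
    length-snoc = trans (LP.length-++ js) (trans (NP.+-comm (length js) 1) (cong suc len))
    word≈w : (id ·word (js ++ [ i ])) ≈ w
    word≈w = ≈-trans {id ·word (js ++ [ i ])} {(w · s i) · s i} {w}
      (subst (_≈ ((w · s i) · s i)) (sym (·word-snoc id js i)) (·-congˡ {id ·word js} {w · s i} (s i) js≈))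
      (s-involutive w i)

  hasLength-ninv : ∀ w → HasLength w (ninv w)
  hasLength-ninv w with reducedWord (ninv w) w refl
  ... | js , len , js≈w = (js , len , js≈w) , (λ js' e' → ninv≤length js' w e')

  hasLength-unique : ∀ {w k} → HasLength w k → k ≡ ninv w
  hasLength-unique {w} {k} ((js , len , js≈w) , minimal) with reducedWord (ninv w) w refl
  ... | js' , len' , js'≈w =
    NP.≤-antisym (subst (k ≤_) len' (minimal js' js'≈w)) (subst (ninv w ≤_) len (ninv≤length js w js≈w))

  additive-head : ∀ u j js → ninv (u ·word (j ∷ js)) ≡ ninv u + suc (length js) →
                  Σ (Ascent u j) λ _ → ninv ((u · s j) ·word js) ≡ ninv (u · s j) + length js
  additive-head u j js e with ascent-or-descent u j
  ... | inj₁ asc = asc , trans e (trans (NP.+-suc (ninv u) (length js)) (cong (_+ length js) (sym (ninv-ascent u j asc))))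
  ... | inj₂ dsc = ⊥-elim (NP.<-irrefl refl (NP.≤-<-trans (NP.≤-reflexive (sym e)) too-few))
    where
    too-few : ninv ((u · s j) ·word js) < ninv u + suc (length js)
    too-few = NP.≤-<-trans (ninv-word≤ js (u · s j))
      (subst (ninv (u · s j) + length js <_) (sym (NP.+-suc (ninv u) (length js)))
        (NP.m<n⇒m<1+n (NP.+-monoˡ-< (length js) (subst (ninv (u · s j) <_) (sym (ninv-descent u j dsc)) NP.≤-refl))))

  additive⇒⊑ : ∀ (js : List (Fin m)) u → ninv (u ·word js) ≡ ninv u + length js → u ⊑ (u ·word js)
  additive⇒⊑ []       u e inv = inv
  additive⇒⊑ (j ∷ js) u e inv with additive-head u j js e
  ... | asc , e' = additive⇒⊑ js (u · s j) e' (inversions-kept u j asc inv)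

-- The right weak order is inclusion of inversion sets.
module WeakOrder (m : ℕ) where
  open Permutations m
  open Inversions m
  open Length m

  -- a witness of w ≤R τ is a word adding one inversion per letter
  ≤R⇒⊑ : ∀ {w τ : Perm} → w ≤R τ → w ⊑ τ
  ≤R⇒⊑ {w} {τ} (js , js≈ , lw , lτ , hw , hτ , lτ≡) inv =
    Inversion-cong {w ·word js} {τ} js≈ (additive⇒⊑ js w additive inv)
    where
    additive : ninv (w ·word js) ≡ ninv w + length js
    additive = trans (ninv-cong {w ·word js} {τ} js≈) (trans (sym (hasLength-unique {τ} hτ))
                 (trans lτ≡ (cong (_+ length js) (hasLength-unique {w} hw))))

  UsefulAscent : Perm → Perm → Fin m → Set
  UsefulAscent w τ i = Σ (Ascent w i) λ asc → Inversion τ (created w i asc)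

  usefulAscent? : ∀ w τ i → Dec (UsefulAscent w τ i)
  usefulAscent? w τ i with at w (inject₁ i) F.<? at w (F.suc i)
  ... | no ¬asc = no (λ u → ¬asc (proj₁ u))
  ... | yes asc with Inversion? τ (created w i asc)
  ...   | yes inv = yes (asc , inv)
  ...   | no ¬inv = no (λ { (asc' , inv') →
                      ¬inv (subst (λ a → Inversion τ (created w i a)) (FP.<-irrelevant asc' asc) inv') })

  useful-step : ∀ {w τ i} (u : UsefulAscent w τ i) → w ⊑ τ → (w · s i) ⊑ τ
  useful-step {w} {i = i} (asc , inv) w⊑τ inv' with inversions-added w i asc inv'
  ... | inj₁ old  = w⊑τ old
  ... | inj₂ refl = inv

  -- If w ⊑ τ, then w can be extended to τ by k = ninv τ ∸ ninv w letters,
  -- each along a useful ascent.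
  climb : ∀ k (w τ : Perm) → w ⊑ τ → ninv w + k ≡ ninv τ →
          Σ (List (Fin m)) λ js → (w ·word js) ≈ τ × length js ≡ k
  climb k w τ w⊑τ e with FP.any? (usefulAscent? w τ)
  climb k w τ w⊑τ e | no none = [] , w≈τ , sym (NP.+-cancelˡ-≡ (ninv w) k 0 k≡0)
    where
    w≈τ : w ≈ τ
    w≈τ = ⊑-without-created⇒≈ w τ w⊑τ (λ i asc inv → none (i , asc , inv))
    k≡0 : ninv w + k ≡ ninv w + 0
    k≡0 = trans e (trans (sym (ninv-cong {w} {τ} w≈τ)) (sym (NP.+-identityʳ (ninv w))))
  climb zero w τ w⊑τ e | yes (i , u@(asc , _)) = ⊥-elim (NP.<-irrefl refl (NP.<-≤-trans more fewer))
    where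
    more : ninv w < ninv (w · s i)
    more = subst (ninv w <_) (sym (ninv-ascent w i asc)) NP.≤-refl
    fewer : ninv (w · s i) ≤ ninv w
    fewer = subst (ninv (w · s i) ≤_) (trans (sym e) (NP.+-identityʳ (ninv w))) (ninv-mono (useful-step u w⊑τ))
  climb (suc k) w τ w⊑τ e | yes (i , u@(asc , _))
    with climb k (w · s i) τ (useful-step u w⊑τ)
               (trans (cong (_+ k) (ninv-ascent w i asc)) (trans (sym (NP.+-suc (ninv w) k)) e))
  ... | js , js≈ , len = i ∷ js , js≈ , cong suc len

  ⊑⇒≤R : ∀ {w τ : Perm} → w ⊑ τ → w ≤R τ
  ⊑⇒≤R {w} {τ} w⊑τ with climb (ninv τ ∸ ninv w) w τ w⊑τ (NP.m+[n∸m]≡n (ninv-mono w⊑τ))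
  ... | js , js≈ , len = js , js≈ , ninv w , ninv τ , hasLength-ninv w , hasLength-ninv τ ,
        trans (sym (NP.m+[n∸m]≡n (ninv-mono w⊑τ))) (cong (ninv w +_) (sym len))

-- Peeling 𝒜 along inversion sets.  If the deleted vertices ds are exactly
-- the inversions of u, the value of a remaining vertex (c,d) is the number
-- of entries of u strictly between c and d in value that also lie strictly
-- between them in position; so (c,d) has value 0 iff nothing separates c
-- and d, and the erasable vertices are exactly the vertices created at the
-- ascents of u.
module InversionPeeling (m : ℕ) where
  open Permutations m
  open Inversions m
  open Peeling (𝒜 (suc m))

  record Represents (ds : List Vx) (u : Perm) : Set where
    field
      unique   : Unique ds
      sound    : ∀ {y} → y ∈ ds → Inversion u y
      complete : ∀ {y} → Inversion u y → y ∈ ds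
  open Represents public

  represents-id : Represents [] id
  represents-id = record { unique = [] ; sound = λ () ; complete = λ inv → ⊥-elim (no-inversion-id inv) }

  represents-inversions : ∀ w → Represents (inversions w) w
  represents-inversions w = record
    { unique = unique-inversions w ; sound = ∈-inversions⁻ ; complete = ∈-inversions⁺ }

  represents-step : ∀ {ds u} → Represents ds u → ∀ i asc → Represents (ds ++ [ created u i asc ]) (u · s i)
  represents-step {ds} {u} rep i asc = record
    { unique   = UP.++⁺ (unique rep) (All.[] ∷ []) disjoint
    ; sound    = sound′
    ; complete = complete′
    }
    where
    disjoint : ∀ {v} → ¬ (v ∈ ds × v ∈ [ created u i asc ])
    disjoint (v∈ds , here refl) = created-new u i asc (sound rep v∈ds)
    sound′ : ∀ {y} → y ∈ ds ++ [ created u i asc ] → Inversion (u · s i) y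
    sound′ y∈ with ∈-++⁻ ds y∈
    ... | inj₁ y∈ds       = inversions-kept u i asc (sound rep y∈ds)
    ... | inj₂ (here refl) = created-after u i asc
    complete′ : ∀ {y} → Inversion (u · s i) y → y ∈ ds ++ [ created u i asc ]
    complete′ inv with inversions-added u i asc inv
    ... | inj₁ old  = ∈-++⁺ˡ (complete rep old)
    ... | inj₂ refl = ∈-++⁺ʳ ds (here refl)

  Separated : Perm → Pt → Pt → Set
  Separated u c d = Σ Pt λ k → c F.< k × k F.< d × pos u c F.< pos u k × pos u k F.< pos u d

  pos-< : ∀ {u : Perm} {c d : Pt} (c<d : c F.< d) → ¬ Inversion u ((c , d) , c<d) → pos u c F.< pos u d
  pos-< {u} c<d ¬inv = FP.≤∧≢⇒< (NP.≮⇒≥ (λ lt → ¬inv (inversion lt)))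
                                 (λ e → FP.<⇒≢ c<d (pos-injective u e))

  -- The middle value k of an arc  (c,d) → (c,k)  or  (c,d) → (k,d).
  middle : Pt → Vx → ℕ
  middle c ((e , f) , _) with e FP.≟ c
  ... | yes _ = toℕ f
  ... | no _  = toℕ e

  middle-arc : ∀ {c d : Pt} {c<d} {x : Vx} (arc : Arc ((c , d) , c<d) x) → middle c x ≡ toℕ (proj₁ arc)
  middle-arc {c} (k , _ , _ , inj₁ (refl , refl)) with c FP.≟ c
  ... | yes _  = refl
  ... | no c≢c = ⊥-elim (c≢c refl)
  middle-arc {c} (k , c<k , _ , inj₂ (refl , refl)) with k FP.≟ c
  ... | yes k≡c = ⊥-elim (FP.<⇒≢ c<k (sym k≡c))
  ... | no _    = refl

  module Value {ds u} (rep : Represents ds u) {c d : Pt} (c<d : c F.< d)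
               (¬inv : ¬ Inversion u ((c , d) , c<d)) where
    private
      y : Vx
      y = (c , d) , c<d

      targets : List Vx
      targets = filter (Arc? y) ds
      middles : List ℕ
      middles = map (middle c) targets

      c≺d : pos u c F.< pos u d
      c≺d = pos-< c<d ¬inv

      -- a middle value k is not separating: an arc (c,d) → (c,k) into an
      -- inversion puts k before c, an arc (c,d) → (k,d) puts k after d
      middle-outside : ∀ {z} → z ∈ middles → Σ Pt λ k → z ≡ toℕ k × c F.< k × k F.< d ×
                         (pos u k F.< pos u c ⊎ pos u d F.< pos u k)
      middle-outside z∈ with ∈-map⁻ (middle c) z∈
      ... | x , x∈ , refl with ∈-filter⁻ (Arc? y) {xs = ds} x∈
      ... | x∈ds , arc with arc | middle-arc {c} {d} {c<d} {x} arc | sound rep x∈ds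
      ... | k , c<k , k<d , inj₁ (refl , refl) | e | inv = k , e , c<k , k<d , inj₁ (inverted inv)
      ... | k , c<k , k<d , inj₂ (refl , refl) | e | inv = k , e , c<k , k<d , inj₂ (inverted inv)

      -- distinct targets have distinct middles: (c,k) and (k,d) cannot both
      -- be inversions, as that would put d before c
      unique-middles : Unique middles
      unique-middles = unique-map (middle c) (UP.filter⁺ (Arc? y) (unique rep)) injective
        where
        d-before-c : ∀ k k' → k ≡ k' → pos u k F.< pos u c → pos u d F.< pos u k' → ⊥
        d-before-c k .k refl k≺c d≺k = NP.<-asym c≺d (FP.<-trans d≺k k≺c)

        injective : ∀ {x x'} → x ∈ targets → x' ∈ targets → middle c x ≡ middle c x' → x ≡ x'
        injective {x} {x'} x∈ x'∈ e with ∈-filter⁻ (Arc? y) {xs = ds} x∈ | ∈-filter⁻ (Arc? y) {xs = ds} x'∈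
        ... | x∈ds , arc | x'∈ds , arc'
            with arc | arc' | middle-arc {c} {d} {c<d} {x} arc | middle-arc {c} {d} {c<d} {x'} arc'
               | sound rep x∈ds | sound rep x'∈ds
        ... | k , _ , _ , inj₁ (refl , refl) | k' , _ , _ , inj₁ (refl , refl) | e₁ | e₂ | _ | _ =
              vertex-≡ refl (FP.toℕ-injective (trans (sym e₁) (trans e e₂)))
        ... | k , _ , _ , inj₂ (refl , refl) | k' , _ , _ , inj₂ (refl , refl) | e₁ | e₂ | _ | _ =
              vertex-≡ (FP.toℕ-injective (trans (sym e₁) (trans e e₂))) refl
        ... | k , _ , _ , inj₁ (refl , refl) | k' , _ , _ , inj₂ (refl , refl) | e₁ | e₂ | inv | inv' =
              ⊥-elim (d-before-c k k' (FP.toℕ-injective (trans (sym e₁) (trans e e₂))) (inverted inv) (inverted inv'))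
        ... | k , _ , _ , inj₂ (refl , refl) | k' , _ , _ , inj₁ (refl , refl) | e₁ | e₂ | inv | inv' =
              ⊥-elim (d-before-c k' k (FP.toℕ-injective (trans (sym e₂) (trans (sym e) e₁))) (inverted inv') (inverted inv))


      length-middles : length middles ≡ length targets
      length-middles = LP.length-map (middle c) targets

    -- if nothing separates c and d, every k strictly between them is the
    -- middle of a deleted target, so the value has dropped to 0
    value-zero : ¬ Separated u c d → val ds y ≡ 0
    value-zero unseparated = NP.m≤n⇒m∸n≡0
      (subst₂ _≤_ (length-between (toℕ c) (toℕ d)) length-middles
        (unique⊆⇒length≤ (unique-between _ _) between⊆middles))
      where
      arc-middle∈ : (x : Vx) (arc : Arc y x) → pos u (proj₂ (proj₁ x)) F.< pos u (proj₁ (proj₁ x)) → toℕ (proj₁ arc) ∈ middles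
      arc-middle∈ x arc inv = subst (_∈ middles) (middle-arc {c} {d} {c<d} {x} arc)
        (∈-map⁺ (middle c) (∈-filter⁺ (Arc? y) (complete rep {x} (inversion inv)) arc))

      middle-of : ∀ (k : Pt) → c F.< k → k F.< d → toℕ k ∈ middles
      middle-of k c<k k<d with FP.<-cmp (pos u k) (pos u c)
      ... | tri< k≺c _ _ = arc-middle∈ ((c , k) , c<k) (k , c<k , k<d , inj₁ (refl , refl)) k≺c
      ... | tri≈ _ e _   = ⊥-elim (FP.<⇒≢ c<k (sym (pos-injective u e)))
      ... | tri> _ _ c≺k with FP.<-cmp (pos u k) (pos u d)
      ...   | tri< k≺d _ _ = ⊥-elim (unseparated (k , c<k , k<d , c≺k , k≺d))
      ...   | tri≈ _ e _   = ⊥-elim (FP.<⇒≢ k<d (pos-injective u e))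
      ...   | tri> _ _ d≺k = arc-middle∈ ((k , d) , k<d) (k , c<k , k<d , inj₂ (refl , refl)) d≺k

      between⊆middles : ∀ {z} → z ∈ between (toℕ c) (toℕ d) → z ∈ middles
      between⊆middles {z} z∈ = subst (_∈ middles) (FP.toℕ-fromℕ< z<n) (middle-of k c<k k<d)
        where
        c<z : toℕ c < z
        c<z = proj₁ (∈-between⁻ c<d z∈)
        z<d : z < toℕ d
        z<d = proj₂ (∈-between⁻ c<d z∈)
        z<n : z < suc m
        z<n = NP.<-trans z<d (FP.toℕ<n d)
        k : Pt
        k = fromℕ< z<n
        c<k : c F.< k
        c<k = subst (toℕ c <_) (sym (FP.toℕ-fromℕ< z<n)) c<z
        k<d : k F.< d
        k<d = subst (_< toℕ d) (sym (FP.toℕ-fromℕ< z<n)) z<d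

    -- a separating k is strictly between c and d but is no middle, so the
    -- value is still positive
    value-nonzero : Separated u c d → val ds y ≢ 0
    value-nonzero (k , c<k , k<d , c≺k , k≺d) val≡0 = NP.<-irrefl refl (NP.≤-<-trans θ≤ θ>)
      where
      θ≤ : toℕ d ∸ toℕ c ∸ 1 ≤ length targets
      θ≤ = NP.m∸n≡0⇒m≤n val≡0
      k∉middles : toℕ k ∉ middles
      k∉middles k∈ with middle-outside k∈
      ... | k' , e , _ , _ , inj₁ k'≺c =
        NP.<-asym c≺k (subst (λ z → pos u z F.< pos u c) (sym (FP.toℕ-injective e)) k'≺c)
      ... | k' , e , _ , _ , inj₂ d≺k' =
        NP.<-asym k≺d (subst (λ z → pos u d F.< pos u z) (sym (FP.toℕ-injective e)) d≺k')
      into-between : ∀ {z} → z ∈ toℕ k ∷ middles → z ∈ between (toℕ c) (toℕ d)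
      into-between (here refl) = ∈-between⁺ c<k k<d
      into-between (there z∈) with middle-outside z∈
      ... | k' , refl , c<k' , k'<d , _ = ∈-between⁺ c<k' k'<d
      θ> : length targets < toℕ d ∸ toℕ c ∸ 1
      θ> = subst₂ _≤_ (cong suc length-middles) (length-between (toℕ c) (toℕ d))
             (unique⊆⇒length≤ (All.tabulate (λ z∈ k≡z → k∉middles (subst (_∈ middles) (sym k≡z) z∈)) ∷ unique-middles)
                              into-between)

  module Erasure {ds u} (rep : Represents ds u) where
    ¬inversion : ∀ {y} → y ∉ ds → ¬ Inversion u y
    ¬inversion y∉ds inv = y∉ds (complete rep inv)

    ∉-deleted : ∀ {y} → ¬ Inversion u y → y ∉ ds
    ∉-deleted ¬inv y∈ds = ¬inv (sound rep y∈ds)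

    created-erasable : ∀ i asc → Erasable ds (created u i asc)
    created-erasable i asc =
      ∉-deleted (created-new u i asc) ,
      Value.value-zero rep asc (created-new u i asc) unseparated ,
      predecessor-nonzero
      where
      A B : Pt
      A = at u (inject₁ i)
      B = at u (F.suc i)
      adjacent : toℕ (pos u B) ≡ suc (toℕ (pos u A))
      adjacent = trans (cong toℕ (pos-at u (F.suc i)))
                       (cong suc (sym (trans (cong toℕ (pos-at u (inject₁ i))) (FP.toℕ-inject₁ i))))
      unseparated : ¬ Separated u A B
      unseparated (k , _ , _ , A≺k , k≺B) =
        NP.<-irrefl refl (NP.<-≤-trans A≺k (NP.≤-pred (subst (toℕ (pos u k) <_) adjacent k≺B)))
      -- a predecessor (A,d) is separated by B, a predecessor (c,B) by A
      predecessor-nonzero : ∀ z → z ∉ ds → Arc z (created u i asc) → val ds z ≢ 0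
      predecessor-nonzero ((c , d) , c<d) z∉ds (k , c<k , k<d , inj₁ (refl , refl)) =
        Value.value-nonzero rep c<d (¬inversion z∉ds)
          (B , c<k , k<d , subst (suc (toℕ (pos u A)) ≤_) (sym adjacent) NP.≤-refl ,
           FP.≤∧≢⇒< (subst (_≤ toℕ (pos u d)) (sym adjacent) (pos-< c<d (¬inversion z∉ds)))
                    (λ e → FP.<⇒≢ k<d (pos-injective u e)))
      predecessor-nonzero ((c , d) , c<d) z∉ds (k , c<k , k<d , inj₂ (refl , refl)) =
        Value.value-nonzero rep c<d (¬inversion z∉ds)
          (A , c<k , k<d ,
           FP.≤∧≢⇒< (NP.≤-pred (subst (toℕ (pos u c) <_) adjacent (pos-< c<d (¬inversion z∉ds))))
                    (λ e → FP.<⇒≢ c<k (pos-injective u e)) ,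
           subst (suc (toℕ (pos u A)) ≤_) (sym adjacent) NP.≤-refl)

    -- Conversely, let (a,b) be erasable.  Its value is 0, so nothing
    -- separates a and b; and no predecessor has value 0.  This forces a and b
    -- to stand next to each other in u, with a first.
    module _ {a b : Pt} {a<b : a F.< b} (erasable : Erasable ds ((a , b) , a<b)) where
      private
        ¬inv : ¬ Inversion u ((a , b) , a<b)
        ¬inv = ¬inversion (proj₁ erasable)

        a≺b : pos u a F.< pos u b
        a≺b = pos-< a<b ¬inv

        unseparated : ¬ Separated u a b
        unseparated sep = Value.value-nonzero rep a<b ¬inv sep (proj₁ (proj₂ erasable))

        predecessor-separated : ∀ {c d} (c<d : c F.< d) → pos u c F.< pos u d →
                                Arc ((c , d) , c<d) ((a , b) , a<b) → ¬ Separated u c d → ⊥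
        predecessor-separated c<d c≺d arc unsep =
          proj₂ (proj₂ erasable) _ (∉-deleted ¬inv′) arc (Value.value-zero rep c<d ¬inv′ unsep)
          where
          ¬inv′ : ¬ Inversion u (_ , c<d)
          ¬inv′ inv = NP.<-asym c≺d (inverted inv)

        Window : Pt → Set
        Window v = pos u a F.< pos u v × pos u v F.< pos u b

        window? : ∀ v → Dec (Window v)
        window? v = (pos u a F.<? pos u v) ×-dec (pos u v F.<? pos u b)

        -- no window entry has a value above b: the leftmost such d would make
        -- the predecessor (a,d) unseparated
        nothing-above : ∀ v → Window v → b F.< v → ⊥
        nothing-above v win b<v with leastWitness (λ v → Window v × b F.< v) (λ v → window? v ×-dec (b F.<? v)) (win , b<v)
        ... | d , ((a≺d , d≺b) , b<d) , leftmost =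
          predecessor-separated (FP.<-trans a<b b<d) a≺d (b , a<b , b<d , inj₁ (refl , refl)) unsep
          where
          unsep : ¬ Separated u a d
          unsep (k , a<k , k<d , a≺k , k≺d) with FP.<-cmp k b
          ... | tri< k<b _ _ = unseparated (k , a<k , k<b , a≺k , FP.<-trans k≺d d≺b)
          ... | tri≈ _ refl _ = NP.<-asym k≺d d≺b
          ... | tri> _ _ b<k = NP.<-irrefl refl (NP.<-≤-trans k<d (leftmost k ((a≺k , FP.<-trans k≺d d≺b) , b<k)))

        -- so all window entries have values below a
        below : ∀ v → Window v → v F.< a
        below v win@(a≺v , v≺b) with FP.<-cmp v a | FP.<-cmp v b
        ... | tri< v<a _ _ | _            = v<a
        ... | tri≈ _ refl _ | _           = ⊥-elim (NP.<-irrefl refl a≺v)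
        ... | tri> _ _ a<v | tri< v<b _ _ = ⊥-elim (unseparated (v , a<v , v<b , win))
        ... | tri> _ _ _   | tri≈ _ refl _ = ⊥-elim (NP.<-irrefl refl v≺b)
        ... | tri> _ _ _   | tri> _ _ b<v = ⊥-elim (nothing-above v win b<v)

        -- and there is none: the rightmost one c would make the predecessor
        -- (c,b) unseparated
        empty-window : ∀ v → Window v → ⊥
        empty-window v win with greatestWitness Window window? win
        ... | c , (a≺c , c≺b) , rightmost =
          predecessor-separated (FP.<-trans c<a a<b) c≺b (a , c<a , a<b , inj₂ (refl , refl)) unsep
          where
          c<a : c F.< a
          c<a = below c (a≺c , c≺b)
          unsep : ¬ Separated u c b
          unsep (k , c<k , _ , c≺k , k≺b) = NP.<-irrefl refl (NP.<-≤-trans c<k (rightmost k (FP.<-trans a≺c c≺k , k≺b)))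

        adjacent : toℕ (pos u b) ≡ suc (toℕ (pos u a))
        adjacent with toℕ (pos u b) NP.≟ suc (toℕ (pos u a))
        ... | yes e = e
        ... | no ≢ = ⊥-elim (empty-window (at u next) (subst (pos u a F.<_) (sym (pos-at u next)) a≺next ,
                                                    subst (F._< pos u b) (sym (pos-at u next)) next≺b))
          where
          gap : suc (toℕ (pos u a)) < toℕ (pos u b)
          gap = NP.≤∧≢⇒< a≺b (λ e → ≢ (sym e))
          next< : suc (toℕ (pos u a)) < suc m
          next< = NP.<-trans gap (FP.toℕ<n (pos u b))
          next : Pt
          next = fromℕ< next<
          a≺next : pos u a F.< next
          a≺next = subst (toℕ (pos u a) <_) (sym (FP.toℕ-fromℕ< next<)) NP.≤-refl
          next≺b : next F.< pos u b
          next≺b = subst (_< toℕ (pos u b)) (sym (FP.toℕ-fromℕ< next<)) gap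

        as-created : ∀ p → pos u b ≡ p → Σ (Fin m) λ i → Σ (Ascent u i) λ asc → ((a , b) , a<b) ≡ created u i asc
        as-created F.zero    b≡ = ⊥-elim (NP.0≢1+n (trans (sym (cong toℕ b≡)) adjacent))
        as-created (F.suc i) b≡ = i , subst₂ F._<_ (sym a≡) (sym b≡′) a<b , vertex-≡ (sym a≡) (sym b≡′)
          where
          a≡ : at u (inject₁ i) ≡ a
          a≡ = trans (cong (at u) (FP.toℕ-injective (trans (FP.toℕ-inject₁ i)
                       (NP.suc-injective (trans (sym (cong toℕ b≡)) adjacent))))) (at-pos u a)
          b≡′ : at u (F.suc i) ≡ b
          b≡′ = trans (cong (at u) (sym b≡)) (at-pos u b)

      erasable⇒created : Σ (Fin m) λ i → Σ (Ascent u i) λ asc → ((a , b) , a<b) ≡ created u i asc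
      erasable⇒created = as-created (pos u b) refl

-- Peeling sequences of 𝒜 versus reduced words: the prefixes of peeling
-- sequences are exactly the inversion sets.
module PeelingSequences (m : ℕ) where
  open Permutations m
  open Inversions m
  open Length m
  open InversionPeeling m
  open Peeling (𝒜 (suc m))

  -- xs is a valid run of the peeling process started after deleting pre;
  -- ValidRun xs is  RunFrom [] xs
  RunFrom : List Vx → List Vx → Set
  RunFrom pre xs = ∀ (i : Fin (length xs)) → Erasable (pre ++ take (toℕ i) xs) (lookup xs i)

  Stuck : List Vx → Set
  Stuck ds = ∀ x → ¬ Erasable ds x

  run-cons : ∀ {pre x xs} → Erasable pre x → RunFrom (pre ++ [ x ]) xs → RunFrom pre (x ∷ xs)
  run-cons {pre} {x} {xs} ex run F.zero = subst (λ z → Erasable z x) (sym (LP.++-identityʳ pre)) ex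
  run-cons {pre} {x} {xs} ex run (F.suc j) =
    subst (λ z → Erasable z (lookup xs j)) (LP.++-assoc pre [ x ] (take (toℕ j) xs)) (run j)

  run-head : ∀ {pre x xs} → RunFrom pre (x ∷ xs) → Erasable pre x
  run-head {pre} {x} run = subst (λ z → Erasable z x) (LP.++-identityʳ pre) (run F.zero)

  run-tail : ∀ {pre x xs} → RunFrom pre (x ∷ xs) → RunFrom (pre ++ [ x ]) xs
  run-tail {pre} {x} {xs} run j =
    subst (λ z → Erasable z (lookup xs j)) (sym (LP.++-assoc pre [ x ] (take (toℕ j) xs))) (run (F.suc j))

  stuck-cons : ∀ {pre x xs} → Stuck ((pre ++ [ x ]) ++ xs) → Stuck (pre ++ x ∷ xs)
  stuck-cons {pre} {x} {xs} stuck y ey = stuck y (subst (λ z → Erasable z y) (sym (LP.++-assoc pre [ x ] xs)) ey)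

  -- Every prefix of a run, started from an inversion set, is an inversion set:
  -- each erased vertex is created at an ascent.
  prefix-represents : ∀ xs pre u → Represents pre u → RunFrom pre xs → ∀ k → k ≤ length xs →
                      Σ Perm λ u' → Represents (pre ++ take k xs) u'
  prefix-represents xs pre u rep run zero _ = u , subst (λ z → Represents z u) (sym (LP.++-identityʳ pre)) rep
  prefix-represents (x ∷ xs) pre u rep run (suc k) (s≤s k≤)
    with Erasure.erasable⇒created rep (run-head {pre} {x} {xs} run)
  ... | i , asc , refl
      with prefix-represents xs (pre ++ [ x ]) (u · s i) (represents-step rep i asc) (run-tail {pre} {x} {xs} run) k k≤
  ...   | u' , rep' = u' , subst (λ z → Represents z u') (LP.++-assoc pre [ x ] (take k xs)) rep'

  -- From any inversion set the process can be run until it stops, erasing at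
  -- each step the vertex created at some ascent; the fuel bounds the number
  -- of inversions still to be created.
  run-to-end : ∀ fuel pre u → Represents pre u → length allVertices ≤ ninv u + fuel →
               Σ (List Vx) λ zs → RunFrom pre zs × Stuck (pre ++ zs)
  run-to-end fuel pre u rep bound with FP.any? (λ i → at u (inject₁ i) F.<? at u (F.suc i))
  ... | no noAscent = [] , (λ ()) , λ x ex →
        noAscent (ascent-of x (subst (λ z → Erasable z x) (LP.++-identityʳ pre) ex))
    where
    ascent-of : ∀ x → Erasable pre x → Σ (Fin m) (Ascent u)
    ascent-of x ex with Erasure.erasable⇒created rep ex
    ... | i , asc , _ = i , asc
  run-to-end zero pre u rep bound | yes (i , asc) = ⊥-elim (NP.<-irrefl refl (NP.<-≤-trans
      (subst (_< ninv (u · s i)) (sym (NP.+-identityʳ (ninv u))) (subst (ninv u <_) (sym (ninv-ascent u i asc)) NP.≤-refl))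
      (NP.≤-trans (ninv≤#vertices (u · s i)) bound)))
  run-to-end (suc fuel) pre u rep bound | yes (i , asc)
    with run-to-end fuel (pre ++ [ created u i asc ]) (u · s i) (represents-step rep i asc)
           (subst (length allVertices ≤_) (trans (NP.+-suc (ninv u) fuel) (cong (_+ fuel) (sym (ninv-ascent u i asc)))) bound)
  ... | zs , run , stuck = created u i asc ∷ zs ,
        run-cons {pre} {created u i asc} {zs} (Erasure.created-erasable rep i asc) run ,
        stuck-cons {pre} {created u i asc} {zs} stuck

  -- Following a word that adds one inversion per letter erases the created
  -- vertices in turn; then the process is run to its end.  The prefix erased
  -- along the word represents  u ·word js.
  run-along : ∀ (js : List (Fin m)) pre u → Represents pre u → ninv (u ·word js) ≡ ninv u + length js →
              Σ (List Vx) λ xs → RunFrom pre xs × Stuck (pre ++ xs) ×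
                Σ ℕ λ k → k ≤ length xs × Represents (pre ++ take k xs) (u ·word js)
  run-along [] pre u rep _ with run-to-end (length allVertices) pre u rep (NP.m≤n+m _ _)
  ... | zs , run , stuck = zs , run , stuck , 0 , z≤n , subst (λ z → Represents z u) (sym (LP.++-identityʳ pre)) rep
  run-along (j ∷ js) pre u rep additive with additive-head u j js additive
  ... | asc , additive′ with run-along js (pre ++ [ created u j asc ]) (u · s j) (represents-step rep j asc) additive′
  ...   | xs , run , stuck , k , k≤ , rep′ =
          created u j asc ∷ xs ,
          run-cons {pre} {created u j asc} {xs} (Erasure.created-erasable rep j asc) run ,
          stuck-cons {pre} {created u j asc} {xs} stuck ,
          suc k , s≤s k≤ ,
          subst (λ z → Represents z ((u · s j) ·word js)) (LP.++-assoc pre [ created u j asc ] (take k xs)) rep′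

  represents-cong : ∀ {ds u v} → u ≈ v → Represents ds u → Represents ds v
  represents-cong {u = u} {v} u≈v rep = record
    { unique   = unique rep
    ; sound    = λ y∈ → Inversion-cong {u} {v} u≈v (sound rep y∈)
    ; complete = λ inv → complete rep (Inversion-cong {v} {u} (≈-sym {u} {v} u≈v) inv)
    }

  same-members : ∀ {X Y w} → Represents X w → Represents Y w → ∀ v → (v ∈ X) ⇔ (v ∈ Y)
  same-members repX repY v = mk⇔ (λ v∈ → complete repY (sound repX v∈)) (λ v∈ → complete repX (sound repY v∈))

  -- the inversion set of w is erased along a reduced word for w
  inversions-in-IS : ∀ w → InIS (inversions w)
  inversions-in-IS w with reducedWord (ninv w) w refl
  ... | js , len , js≈w
      with run-along js [] id represents-id
             (trans (ninv-cong {id ·word js} {w} js≈w) (trans (sym len) (cong (_+ length js) (sym ninv-id))))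
  ...   | xs , run , stuck , k , k≤ , rep =
          xs , (run , stuck) , k , k≤ ,
          same-members (represents-inversions w) (represents-cong {u = id ·word js} {w} js≈w rep)

  IS-inversion-set : ∀ X → InIS X → Σ Perm λ w → ∀ v → (v ∈ inversions w) ⇔ (v ∈ X)
  IS-inversion-set X (xs , (run , _) , k , k≤ , X≡) with prefix-represents xs [] id represents-id run k k≤
  ... | w , rep = w , λ v → ⇔.trans (same-members (represents-inversions w) rep v) (⇔.sym (X≡ v))

theorem4 : (n : ℕ) → 2 ≤ n →
    Σ (Sym n → List (Λ n)) λ f → IsPosetIso n f
theorem4 (suc m) _ = inversions , inversions-in-IS , IS-inversion-set , injective , order
  where
  open Inversions m
  open WeakOrder m
  open PeelingSequences m

  injective : ∀ w τ → (∀ v → (v ∈ inversions w) ⇔ (v ∈ inversions τ)) → w ≈ τ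
  injective w τ same = inversions-injective {w} {τ}
    (⊆⇒⊑ {w} {τ} (λ {v} → Equivalence.to (same v))) (⊆⇒⊑ {τ} {w} (λ {v} → Equivalence.from (same v)))

  order : ∀ w τ → (w ≤R τ) ⇔ (inversions w ⊆ inversions τ)
  order w τ = mk⇔ ≤R⇒⊆ ⊆⇒≤R
    where
    ≤R⇒⊆ : w ≤R τ → inversions w ⊆ inversions τ
    ≤R⇒⊆ w≤τ = ⊑⇒⊆ {w} {τ} (≤R⇒⊑ w≤τ)
    ⊆⇒≤R : inversions w ⊆ inversions τ → w ≤R τ
    ⊆⇒≤R w⊆τ = ⊑⇒≤R (⊆⇒⊑ {w} {τ} w⊆τ)
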